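{- Let $p\geq 3$ be an odd integer and let $k$ be the number of cycles in the cycle decomposition of the permutation $\tau$ of $\{0,1,\dots,p-2\}$ defined by $\tau(j)\equiv 2j+1\pmod p$. (1) If $p=p_1^{\ell}$, where $p_1$ is a prime with $\mu(p_1^2)=\mu(p_1)p_1$ and $\ell\geq 1$ is an integer, then $k=\frac{p_1-1}{\mu(p_1)}\ell$. (2) If $p=p_1p_2$, where $p_1,p_2$ are distinct primes, then \[k=\frac{(p_1-1)(p_2-1)}{\mathrm{lcm}(\mu(p_1),\mu(p_2))}+\frac{p_1-1}{\mu(p_1)}+\frac{p_2-1}{\mu(p_2)}.\]
   Context: For an odd integer $q\geq 3$, $\mu(q)=\mathrm{ord}_q(2)=\min\{j\geq 1: q\mid 2^j-1\}$; $\mathrm{lcm}$ denotes the least common multiple. -}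

module Defs where

open import Data.Bool using (Bool; true; false; if_then_else_)
open import Data.Nat using (ℕ; zero; suc; _+_; _*_; _∸_; _^_; _≤ᵇ_; _/_; _%_)
open import Data.Nat.Divisibility using (_∣?_)
open import Data.List using (List; length; upTo; filterᵇ)
open import Data.Bool.ListAction using (all)
open import Relation.Nullary.Decidable using (does)

ordSearch : ℕ → ℕ → ℕ → ℕ
ordSearch q j zero       = zero
ordSearch q j (suc fuel) = if does (q ∣? (2 ^ j ∸ 1)) then j else ordSearch q (suc j) fuel

-- μ(q) = ord_q(2) = min { j ≥ 1 : q ∣ 2^j - 1 }.
-- For odd q ≥ 3 the order is ≤ φ(q) < q, so searching j = 1..q finds the true minimum.
μ : ℕ → ℕ
μ q = ordSearch q 1 q

-- Exact-style natural division, with the (irrelevant) convention a ÷ 0 = 0.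
_÷_ : ℕ → ℕ → ℕ
a ÷ zero  = zero
a ÷ suc b = a / suc b

τ : ℕ → ℕ → ℕ
τ zero    j = zero
τ (suc n) j = (2 * j + 1) % suc n

τ^ : ℕ → ℕ → ℕ → ℕ
τ^ p zero    j = j
τ^ p (suc i) j = τ p (τ^ p i j)

-- j is the least element of its τ-cycle: j ≤ τ^i(j) for all i < p
-- (every cycle of a permutation of {0,…,p-2} has length ≤ p-1 < p).
isCycleMin : ℕ → ℕ → Bool
isCycleMin p j = all (λ i → j ≤ᵇ τ^ p i j) (upTo p)

-- Number of cycles of τ on {0,1,…,p-2} = number of cycles = number of cycle minima.
numCycles : ℕ → ℕ
numCycles p = length (filterᵇ (isCycleMin p) (upTo (p ∸ 1)))

module Submission where

-- Shifting by one conjugates τ to the doubling map x ↦ 2x mod p on the nonzero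
-- residues, so the cycles of τ are the doubling-orbits of nonzero residues, each counted
-- once by its least element.  The nonzero residues split into classes closed under
-- doubling; in each class every element has the form e·y with y invertible modulo
-- d = p/e, so doubling acts on it with exact period μ(d), and by the orbit-counting
-- lemma the class contributes |class| / μ(d) cycles.
--   (1) p = q^ℓ: the classes are the layers of exact q-adic valuation a < ℓ, of size
--       (q - 1)q^c with a + c + 1 = ℓ; lifting the exponent turns μ(q²) = μ(q)q into
--       μ(q^(c+1)) = μ(q)q^c, so every layer contributes (q - 1)/μ(q).
--   (2) p = p₁p₂: the classes are the nonzero multiples of p₁, those of p₂, and the
--       units, with periods μ(p₂), μ(p₁) and μ(p) = lcm(μ(p₁), μ(p₂)).

open import Defs
open import Data.Nat using (ℕ; zero; suc; _+_; _*_; _∸_; _^_; _/_; _%_; _≤_; _<_; _≤ᵇ_; _≡ᵇ_;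
  z≤n; s≤s; z<s; s<s; s≤s⁻¹; NonZero; >-nonZero; >-nonZero⁻¹; ≢-nonZero; ≢-nonZero⁻¹; nonTrivial⇒≢1; nonTrivial⇒n>1)
open import Data.Nat.Properties
open import Data.Nat.Divisibility
open import Data.Nat.Coprimality using (Coprime; coprime-divisor)
open import Data.Nat.Primality using (Prime; prime⇒irreducible; prime[2]; euclidsLemma; prime⇒nonZero; prime⇒nonTrivial)
open import Data.Fin using (Fin; toℕ; fromℕ<)
open import Data.Fin.Properties using (pigeonhole; toℕ-fromℕ<; toℕ<n)
open import Data.Nat.DivMod
open import Data.Nat.Induction using (<-rec)
open import Data.Nat.LCM using (lcm; m∣lcm[m,n]; n∣lcm[m,n]; lcm-least)
open import Data.Nat.Tactic.RingSolver using (solve-∀)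
open import Data.Bool using (Bool; true; false; _∧_; _∨_; not; T)
open import Data.Bool.Properties using (∧-zeroʳ; ∧-identityʳ; T-∧)
open import Data.Bool.ListAction using (all; and)
open import Data.List using (upTo; applyUpTo; length; filterᵇ)
open import Data.List.Properties using (map-cong)
open import Data.List.Relation.Unary.All using (lookup; tabulate)
open import Data.List.Relation.Unary.All.Properties using (all⁺; all⁻)
open import Data.List.Membership.Propositional.Properties using (∈-upTo⁺; ∈-upTo⁻)
open import Data.Product using (Σ; _×_; _,_; proj₁; proj₂)
open import Data.Sum using (_⊎_; inj₁; inj₂)
open import Data.Empty using (⊥; ⊥-elim)
open import Function using (_∘_; id)
open import Function.Bundles using (Equivalence)
open import Relation.Nullary using (¬_; Dec; yes; no; does)
open import Relation.Nullary.Decidable using (dec-true; dec-false)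
open import Relation.Binary.PropositionalEquality using (_≡_; _≢_; refl; sym; trans; cong; cong₂; subst; subst₂; module ≡-Reasoning)

ind : Bool → ℕ
ind true  = 1
ind false = 0

count : ℕ → (ℕ → Bool) → ℕ
count zero    P = 0
count (suc n) P = ind (P 0) + count n (λ x → P (suc x))

count-cong : ∀ n {P Q : ℕ → Bool} → (∀ x → x < n → P x ≡ Q x) → count n P ≡ count n Q
count-cong zero    _  = refl
count-cong (suc n) eq = cong₂ _+_ (cong ind (eq 0 z<s)) (count-cong n (λ x x<n → eq (suc x) (s<s x<n)))

count-false : ∀ n → count n (λ _ → false) ≡ 0
count-false zero    = refl
count-false (suc n) = count-false n

count-true : ∀ n → count n (λ _ → true) ≡ n
count-true zero    = refl
count-true (suc n) = cong suc (count-true n)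

count-point : ∀ n a → a < n → count n (λ x → x ≡ᵇ a) ≡ 1
count-point (suc n) zero    _         = cong suc (count-false n)
count-point (suc n) (suc a) (s<s a<n) = count-point n a a<n

count-+ : ∀ m k (P : ℕ → Bool) → count (m + k) P ≡ count m P + count k (λ x → P (m + x))
count-+ zero    k P = refl
count-+ (suc m) k P = trans (cong (ind (P 0) +_) (count-+ m k (λ x → P (suc x)))) (sym (+-assoc (ind (P 0)) _ _))

interchange : ∀ a b c d → (a + b) + (c + d) ≡ (a + c) + (b + d)
interchange = solve-∀

count-split : ∀ n (M P Q R : ℕ → Bool) → (∀ x → x < n → ind (P x) ≡ ind (Q x) + ind (R x)) →
              count n (λ x → M x ∧ P x) ≡ count n (λ x → M x ∧ Q x) + count n (λ x → M x ∧ R x)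
count-split zero    M P Q R _     = refl
count-split (suc n) M P Q R split =
  trans (cong₂ _+_ (restrict (M 0) (split 0 z<s))
                   (count-split n (λ x → M (suc x)) (λ x → P (suc x)) (λ x → Q (suc x)) (λ x → R (suc x))
                                (λ x x<n → split (suc x) (s<s x<n))))
        (interchange (ind (M 0 ∧ Q 0)) (ind (M 0 ∧ R 0)) _ _)
  where
  restrict : ∀ m {p q r} → ind p ≡ ind q + ind r → ind (m ∧ p) ≡ ind (m ∧ q) + ind (m ∧ r)
  restrict true  eq = eq
  restrict false _  = refl

T-ext : ∀ {a b} → (T a → T b) → (T b → T a) → a ≡ b
T-ext {false} {false} _   _   = refl
T-ext {false} {true}  _   b⇒a = ⊥-elim (b⇒a _)
T-ext {true}  {false} a⇒b _   = ⊥-elim (a⇒b _)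
T-ext {true}  {true}  _   _   = refl

ind-complement : ∀ a b → (T b → T a) → ind a ≡ ind (a ∧ not b) + ind b
ind-complement false false _   = refl
ind-complement false true  b⇒a = ⊥-elim (b⇒a _)
ind-complement true  false _   = refl
ind-complement true  true  _   = refl

least-or-empty : ∀ n (P : ℕ → Bool) →
  (Σ ℕ λ c → c < n × T (P c) × (∀ y → y < c → P y ≡ false)) ⊎ (∀ x → x < n → P x ≡ false)
least-or-empty zero    P = inj₂ (λ _ ())
least-or-empty (suc n) P with P 0 in P0
... | true  = inj₁ (0 , z<s , subst T (sym P0) _ , λ _ ())
... | false with least-or-empty n (λ x → P (suc x))
...   | inj₁ (c , c<n , Pc , least) = inj₁ (suc c , s<s c<n , Pc , λ { zero _ → P0 ; (suc y) (s<s y<c) → least y y<c })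
...   | inj₂ empty = inj₂ λ { zero _ → P0 ; (suc x) (s<s x<n) → empty x x<n }

does⇒ : ∀ {A : Set} (A? : Dec A) → T (does A?) → A
does⇒ (yes a) _ = a

⇒does : ∀ {A : Set} (A? : Dec A) → A → T (does A?)
⇒does (yes _)  _ = _
⇒does (no ¬a)  a = ¬a a

does-agree : ∀ {P Q : Set} (P? : Dec P) (Q? : Dec Q) → (P → Q) → (Q → P) → does P? ≡ does Q?
does-agree P? Q? P⇒Q Q⇒P = T-ext (⇒does Q? ∘ P⇒Q ∘ does⇒ P?) (⇒does P? ∘ Q⇒P ∘ does⇒ Q?)

difference⁻ : ∀ {A B : Set} (A? : Dec A) (B? : Dec B) → T (does A? ∧ not (does B?)) → A × ¬ B
difference⁻ (yes a) (no ¬b) _ = a , ¬b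

difference⁺ : ∀ {A B : Set} (A? : Dec A) (B? : Dec B) → A → ¬ B → T (does A? ∧ not (does B?))
difference⁺ (yes _) (no _)  _  _  = _
difference⁺ (yes _) (yes b) _  ¬b = ¬b b
difference⁺ (no ¬a) _       a  _  = ¬a a

neither⁻ : ∀ {A B : Set} (A? : Dec A) (B? : Dec B) → T (not (does A?) ∧ not (does B?)) → ¬ A × ¬ B
neither⁻ (no ¬a) (no ¬b) _ = ¬a , ¬b

neither⁺ : ∀ {A B : Set} (A? : Dec A) (B? : Dec B) → ¬ A → ¬ B → T (not (does A?) ∧ not (does B?))
neither⁺ (no _)  (no _)  _  _  = _
neither⁺ (no _)  (yes b) _  ¬b = ¬b b
neither⁺ (yes a) _       ¬a _  = ¬a a

iter : (ℕ → ℕ) → ℕ → ℕ → ℕ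
iter f zero    x = x
iter f (suc i) x = f (iter f i x)

iter-+ : ∀ f i j x → iter f (i + j) x ≡ iter f i (iter f j x)
iter-+ f zero    j x = refl
iter-+ f (suc i) j x = cong f (iter-+ f i j x)

isOrbitMin : (ℕ → ℕ) → ℕ → ℕ → Bool
isOrbitMin f L x = all (λ i → x ≤ᵇ iter f i x) (upTo L)

isOrbitMin⁺ : ∀ f L x → (∀ i → i < L → x ≤ iter f i x) → T (isOrbitMin f L x)
isOrbitMin⁺ f L x below = all⁻ _ (tabulate λ {i} i∈ → ≤⇒≤ᵇ (below i (∈-upTo⁻ i∈)))

isOrbitMin⁻ : ∀ f L x → T (isOrbitMin f L x) → ∀ i → i < L → x ≤ iter f i x
isOrbitMin⁻ f L x min i i<L = ≤ᵇ⇒≤ x _ (lookup (all⁺ _ _ min) (∈-upTo⁺ i<L))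

record ExactPeriod (N : ℕ) (f : ℕ → ℕ) (m : ℕ) (S : ℕ → Bool) : Set where
  field
    closed    : ∀ x → x < N → T (S x) → f x < N × T (S (f x))
    periodic  : ∀ x → x < N → T (S x) → iter f m x ≡ x
    noShorterPeriod : ∀ x → x < N → T (S x) → ∀ i → 0 < i → i < m → iter f i x ≢ x

anyBelow : ℕ → (ℕ → Bool) → Bool
anyBelow zero    g = false
anyBelow (suc m) g = anyBelow m g ∨ g m

anyBelow⁻ : ∀ m g → T (anyBelow m g) → Σ ℕ λ i → i < m × T (g i)
anyBelow⁻ (suc m) g h with anyBelow m g in any
... | true  = let (i , i<m , gi) = anyBelow⁻ m g (subst T (sym any) _) in i , m<n⇒m<1+n i<m , gi
... | false = m , n<1+n m , h

anyBelow⁺ : ∀ m g i → i < m → T (g i) → T (anyBelow m g)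
anyBelow⁺ (suc m) g i i<1+m gi with anyBelow m g in any | m≤n⇒m<n∨m≡n (s≤s⁻¹ i<1+m)
... | true  | _         = _
... | false | inj₁ i<m  = ⊥-elim (subst T any (anyBelow⁺ m g i i<m gi))
... | false | inj₂ refl = gi

module OrbitRemoval {N : ℕ} {f : ℕ → ℕ} {m L : ℕ} (0<m : 0 < m) (m≤L : m ≤ L)
                    {S : ℕ → Bool} (G : ExactPeriod N f m S)
                    (c : ℕ) (c<N : c < N) (Sc : T (S c)) (least : ∀ y → y < c → S y ≡ false) where
  open ExactPeriod G

  orbit⊆S : ∀ i → iter f i c < N × T (S (iter f i c))
  orbit⊆S zero    = c<N , Sc
  orbit⊆S (suc i) = closed _ (proj₁ (orbit⊆S i)) (proj₂ (orbit⊆S i))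

  c-least : ∀ y → T (S y) → c ≤ y
  c-least y Sy = ≮⇒≥ λ y<c → subst T (least y y<c) Sy

  inOrbit : ℕ → Bool
  inOrbit x = anyBelow m (λ i → x ≡ᵇ iter f i c)

  inOrbit⁻ : ∀ x → T (inOrbit x) → Σ ℕ λ i → i < m × x ≡ iter f i c
  inOrbit⁻ x h = let (i , i<m , e) = anyBelow⁻ m _ h in i , i<m , ≡ᵇ⇒≡ x _ e

  inOrbit⁺ : ∀ i → i < m → T (inOrbit (iter f i c))
  inOrbit⁺ i i<m = anyBelow⁺ m _ i i<m (≡⇒≡ᵇ (iter f i c) _ refl)

  inOrbit⇒S : ∀ x → T (inOrbit x) → T (S x)
  inOrbit⇒S x h = let (i , _ , e) = inOrbit⁻ x h in subst (T ∘ S) (sym e) (proj₂ (orbit⊆S i))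

  -- f⁰c, …, f^(m-1)c are pairwise distinct, by primitivity of the period.
  orbit-distinct : ∀ i j → i < j → j < m → iter f i c ≢ iter f j c
  orbit-distinct i j i<j j<m e =
    noShorterPeriod _ (proj₁ (orbit⊆S i)) (proj₂ (orbit⊆S i)) (j ∸ i) (m<n⇒0<n∸m i<j) (≤-<-trans (m∸n≤m j i) j<m)
      (sym (trans e (trans (cong (λ k → iter f k c) (sym (m∸n+n≡m (<⇒≤ i<j)))) (iter-+ f (j ∸ i) i c))))

  orbit-size : count N inOrbit ≡ m
  orbit-size = prefix m ≤-refl
    where
    prefix : ∀ k → k ≤ m → count N (λ x → anyBelow k (λ i → x ≡ᵇ iter f i c)) ≡ k
    prefix zero    _   = count-false N
    prefix (suc k) k<m =
      begin
        count N (λ x → anyBelow k (λ i → x ≡ᵇ iter f i c) ∨ (x ≡ᵇ iter f k c))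
          ≡⟨ count-split N (λ _ → true) _ _ _ (λ x _ → ind-∨ (anyBelow k _) (x ≡ᵇ iter f k c) (new x)) ⟩
        count N (λ x → anyBelow k (λ i → x ≡ᵇ iter f i c)) + count N (λ x → x ≡ᵇ iter f k c)
          ≡⟨ cong₂ _+_ (prefix k (<⇒≤ k<m)) (count-point N _ (proj₁ (orbit⊆S k))) ⟩
        k + 1
          ≡⟨ +-comm k 1 ⟩
        suc k ∎
      where
      open ≡-Reasoning
      ind-∨ : ∀ a b → (T a → T b → ⊥) → ind (a ∨ b) ≡ ind a + ind b
      ind-∨ false b     _        = refl
      ind-∨ true  false _        = refl
      ind-∨ true  true  disjoint = ⊥-elim (disjoint _ _)
      new : ∀ x → T (anyBelow k (λ i → x ≡ᵇ iter f i c)) → T (x ≡ᵇ iter f k c) → ⊥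
      new x old fk = let (i , i<k , e) = anyBelow⁻ k _ old in
        orbit-distinct i k i<k k<m (trans (sym (≡ᵇ⇒≡ x _ e)) (≡ᵇ⇒≡ x _ fk))

  -- Every iterate of c lies on the orbit: reduce the exponent modulo m.
  iter-period-multiple : ∀ t → iter f (t * m) c ≡ c
  iter-period-multiple zero    = refl
  iter-period-multiple (suc t) = begin
    iter f (m + t * m) c         ≡⟨ iter-+ f m (t * m) c ⟩
    iter f m (iter f (t * m) c)  ≡⟨ cong (iter f m) (iter-period-multiple t) ⟩
    iter f m c                   ≡⟨ periodic c c<N Sc ⟩
    c                            ∎
    where open ≡-Reasoning

  iterate-inOrbit : ∀ k → T (inOrbit (iter f k c))
  iterate-inOrbit k = subst (T ∘ inOrbit) (sym reduced) (inOrbit⁺ (k % m) (m%n<n k m))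
    where
    instance
      m-nonZero : NonZero m
      m-nonZero = >-nonZero 0<m
    reduced : iter f k c ≡ iter f (k % m) c
    reduced = begin
      iter f k c                               ≡⟨ cong (λ j → iter f j c) (m≡m%n+[m/n]*n k m) ⟩
      iter f (k % m + k / m * m) c             ≡⟨ iter-+ f (k % m) (k / m * m) c ⟩
      iter f (k % m) (iter f (k / m * m) c)    ≡⟨ cong (iter f (k % m)) (iter-period-multiple (k / m)) ⟩
      iter f (k % m) c                         ∎
      where open ≡-Reasoning

  -- A preimage within S of an orbit point is on the orbit, since x = f^(m-1)(f x).
  orbit-preimage : ∀ x → x < N → T (S x) → T (inOrbit (f x)) → T (inOrbit x)
  orbit-preimage x x<N Sx fx∈O with inOrbit⁻ (f x) fx∈O
  ... | i , _ , fx≡ = subst (T ∘ inOrbit) (sym back) (iterate-inOrbit (m ∸ 1 + i))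
    where
    back : x ≡ iter f (m ∸ 1 + i) c
    back = begin
      x                           ≡⟨ sym (periodic x x<N Sx) ⟩
      iter f m x                  ≡⟨ cong (λ k → iter f k x) (sym (m∸n+n≡m 0<m)) ⟩
      iter f (m ∸ 1 + 1) x        ≡⟨ iter-+ f (m ∸ 1) 1 x ⟩
      iter f (m ∸ 1) (f x)        ≡⟨ cong (iter f (m ∸ 1)) fx≡ ⟩
      iter f (m ∸ 1) (iter f i c) ≡⟨ sym (iter-+ f (m ∸ 1) i c) ⟩
      iter f (m ∸ 1 + i) c        ∎
      where open ≡-Reasoning

  remainder : ℕ → Bool
  remainder x = S x ∧ not (inOrbit x)

  remainder-exact : ExactPeriod N f m remainder
  remainder-exact = record
    { closed    = λ x x<N h → let (Sx , x∉O) = split h ; (fx<N , Sfx) = closed x x<N Sx in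
        fx<N , join Sfx (λ fx∈O → x∉O (orbit-preimage x x<N Sx fx∈O))
    ; periodic  = λ x x<N h → periodic x x<N (proj₁ (split h))
    ; noShorterPeriod = λ x x<N h → noShorterPeriod x x<N (proj₁ (split h)) }
    where
    split : ∀ {x} → T (remainder x) → T (S x) × ¬ T (inOrbit x)
    split {x} h with S x | inOrbit x
    ... | true | false = _ , λ ()
    join : ∀ {y} → T (S y) → ¬ T (inOrbit y) → T (remainder y)
    join {y} Sy y∉O with S y | inOrbit y
    ... | true | false = _
    ... | true | true  = y∉O _

  size-split : count N S ≡ count N remainder + m
  size-split = trans (count-split N (λ _ → true) S remainder inOrbit (λ x _ → ind-complement (S x) (inOrbit x) (inOrbit⇒S x)))
                     (cong (count N remainder +_) orbit-size)

  c-isOrbitMin : T (isOrbitMin f L c)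
  c-isOrbitMin = isOrbitMin⁺ f L c (λ i _ → c-least _ (proj₂ (orbit⊆S i)))

  orbitMin-on-orbit : ∀ i → i < m → T (isOrbitMin f L (iter f i c)) → iter f i c ≡ c
  orbitMin-on-orbit zero    _   _   = refl
  orbitMin-on-orbit (suc i) i<m min = ≤-antisym x≤c (c-least _ (proj₂ (orbit⊆S (suc i))))
    where
    k : ℕ
    k = m ∸ suc i
    returns : iter f k (iter f (suc i) c) ≡ c
    returns = trans (sym (iter-+ f k (suc i) c)) (trans (cong (λ j → iter f j c) (m∸n+n≡m (<⇒≤ i<m))) (periodic c c<N Sc))
    x≤c : iter f (suc i) c ≤ c
    x≤c = subst (_ ≤_) returns (isOrbitMin⁻ f L _ min k (<-≤-trans (∸-monoʳ-< z<s (<⇒≤ i<m)) m≤L))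

  min-on-orbit : ∀ x → x < N → (isOrbitMin f L x ∧ inOrbit x) ≡ (x ≡ᵇ c)
  min-on-orbit x _ = T-ext on-orbit⇒c c⇒on-orbit
    where
    on-orbit⇒c : T (isOrbitMin f L x ∧ inOrbit x) → T (x ≡ᵇ c)
    on-orbit⇒c h with Equivalence.to T-∧ h
    ... | min , onO with inOrbit⁻ x onO
    ...   | i , i<m , refl = ≡⇒≡ᵇ _ c (orbitMin-on-orbit i i<m min)
    c⇒on-orbit : T (x ≡ᵇ c) → T (isOrbitMin f L x ∧ inOrbit x)
    c⇒on-orbit h = subst (λ y → T (isOrbitMin f L y ∧ inOrbit y)) (sym (≡ᵇ⇒≡ x c h))
                         (Equivalence.from T-∧ (c-isOrbitMin , inOrbit⁺ 0 0<m))

  min-split : count N (λ x → isOrbitMin f L x ∧ S x) ≡ count N (λ x → isOrbitMin f L x ∧ remainder x) + 1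
  min-split = trans (count-split N (isOrbitMin f L) S remainder inOrbit (λ x _ → ind-complement (S x) (inOrbit x) (inOrbit⇒S x)))
                    (cong (count N (λ x → isOrbitMin f L x ∧ remainder x) +_) (trans (count-cong N min-on-orbit) (count-point N c c<N)))

-- Orbit counting: if f acts on S with exact period m, then S is a disjoint union of
-- orbits of size m, each containing exactly one orbit minimum.
orbit-count : ∀ {N f m L} → 0 < m → m ≤ L → ∀ S → ExactPeriod N f m S →
              count N (λ x → isOrbitMin f L x ∧ S x) * m ≡ count N S
orbit-count {N} {f} {m} {L} 0<m m≤L S G = <-rec Goal step (count N S) S refl G
  where
  Goal : ℕ → Set
  Goal k = ∀ S → count N S ≡ k → ExactPeriod N f m S → count N (λ x → isOrbitMin f L x ∧ S x) * m ≡ count N S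
  step : ∀ k → (∀ {j} → j < k → Goal j) → Goal k
  step k ih S refl G with least-or-empty N S
  ... | inj₂ empty = begin
      count N (λ x → isOrbitMin f L x ∧ S x) * m ≡⟨ cong (_* m) (count-cong N λ x x<N → trans (cong (isOrbitMin f L x ∧_) (empty x x<N)) (∧-zeroʳ _)) ⟩
      count N (λ _ → false) * m                  ≡⟨ cong (_* m) (count-false N) ⟩
      0                                          ≡⟨ sym (trans (count-cong N empty) (count-false N)) ⟩
      count N S                                  ∎
    where open ≡-Reasoning
  ... | inj₁ (c , c<N , Sc , least) = begin
      count N (λ x → isOrbitMin f L x ∧ S x) * m           ≡⟨ cong (_* m) min-split ⟩
      (count N (λ x → isOrbitMin f L x ∧ remainder x) + 1) * m ≡⟨ *-distribʳ-+ m (count N (λ x → isOrbitMin f L x ∧ remainder x)) 1 ⟩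
      count N (λ x → isOrbitMin f L x ∧ remainder x) * m + 1 * m
        ≡⟨ cong₂ _+_ (ih smaller remainder refl remainder-exact) (*-identityˡ m) ⟩
      count N remainder + m                                 ≡⟨ sym size-split ⟩
      count N S                                             ∎
    where
    open OrbitRemoval 0<m m≤L G c c<N Sc least
    open ≡-Reasoning
    smaller : count N remainder < count N S
    smaller = subst (count N remainder <_) (sym size-split) (m<m+n _ 0<m)

≡-mod⇒∣∸ : ∀ a b d .{{_ : NonZero d}} → a % d ≡ b % d → d ∣ b ∸ a
≡-mod⇒∣∸ a b d e = divides (b / d ∸ a / d) (begin
  b ∸ a                                     ≡⟨ cong₂ _∸_ (m≡m%n+[m/n]*n b d) (m≡m%n+[m/n]*n a d) ⟩
  (b % d + b / d * d) ∸ (a % d + a / d * d) ≡⟨ cong (λ r → (b % d + b / d * d) ∸ (r + a / d * d)) e ⟩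
  (b % d + b / d * d) ∸ (b % d + a / d * d) ≡⟨ [m+n]∸[m+o]≡n∸o (b % d) _ _ ⟩
  b / d * d ∸ a / d * d                     ≡⟨ sym (*-distribʳ-∸ d (b / d) (a / d)) ⟩
  (b / d ∸ a / d) * d                       ∎)
  where open ≡-Reasoning

odd-cancel : ∀ {d} → ¬ 2 ∣ d → ∀ z → d ∣ 2 * z → d ∣ z
odd-cancel {d} odd z = coprime-divisor d⊥2
  where
  d⊥2 : Coprime d 2
  d⊥2 {i} (i∣d , i∣2) with prime⇒irreducible prime[2] i∣2
  ... | inj₁ i≡1    = i≡1
  ... | inj₂ refl   = ⊥-elim (odd i∣d)

odd-cancel-pow : ∀ {d} → ¬ 2 ∣ d → ∀ a z → d ∣ 2 ^ a * z → d ∣ z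
odd-cancel-pow {d} odd zero    z h = subst (d ∣_) (+-identityʳ z) h
odd-cancel-pow {d} odd (suc a) z h = odd-cancel-pow odd a z (odd-cancel odd _ (subst (d ∣_) (*-assoc 2 (2 ^ a) z) h))

odd-pow : ∀ {q} → ¬ 2 ∣ q → ∀ n → ¬ 2 ∣ q ^ n
odd-pow odd zero    h = nonTrivial⇒≢1 {2} (∣1⇒≡1 h)
odd-pow {q} odd (suc n) h with euclidsLemma q (q ^ n) prime[2] h
... | inj₁ 2∣q  = odd 2∣q
... | inj₂ 2∣qⁿ = odd-pow odd n 2∣qⁿ

-- `Cancellable d y`: y is invertible modulo d, i.e. d ∣ z·y forces d ∣ z.
Cancellable : ℕ → ℕ → Set
Cancellable d y = ∀ z → d ∣ z * y → d ∣ z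

prime-cancellable : ∀ {q y} → Prime q → ¬ q ∣ y → Cancellable q y
prime-cancellable {q} {y} q-prime q∤y z h with euclidsLemma z y q-prime h
... | inj₁ q∣z = q∣z
... | inj₂ q∣y = ⊥-elim (q∤y q∣y)

prime-power-cancellable : ∀ {q y} → Prime q → ¬ q ∣ y → ∀ b → Cancellable (q ^ b) y
prime-power-cancellable q-prime q∤y zero    z h = 1∣ z
prime-power-cancellable {q} {y} q-prime q∤y (suc b) z h
  with prime-cancellable q-prime q∤y z (∣-trans (m∣m*n (q ^ b)) h)
... | divides w refl = subst (q * q ^ b ∣_) (*-comm q w) (*-monoʳ-∣ q qᵇ∣w)
  where
  instance
    q-nonZero : NonZero q
    q-nonZero = prime⇒nonZero q-prime
  qᵇ∣w : q ^ b ∣ w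
  qᵇ∣w = prime-power-cancellable q-prime q∤y b w (*-cancelˡ-∣ q (subst (q * q ^ b ∣_) (reassoc w q y) h))
    where
    reassoc : ∀ w q y → w * q * y ≡ q * (w * y)
    reassoc = solve-∀

distinct-primes-∣ : ∀ {p₁ p₂ z} → Prime p₁ → Prime p₂ → p₁ ≢ p₂ → p₁ ∣ z → p₂ ∣ z → p₁ * p₂ ∣ z
distinct-primes-∣ {p₁} {p₂} p₁-prime p₂-prime p₁≢p₂ (divides w refl) p₂∣wp₁ with euclidsLemma w p₁ p₂-prime p₂∣wp₁
... | inj₁ (divides v refl) = divides v (reassoc v p₂ p₁)
  where
  reassoc : ∀ v p₂ p₁ → v * p₂ * p₁ ≡ v * (p₁ * p₂)
  reassoc = solve-∀
... | inj₂ p₂∣p₁ with prime⇒irreducible p₁-prime p₂∣p₁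
...   | inj₁ p₂≡1 = ⊥-elim (nonTrivial⇒≢1 {{prime⇒nonTrivial p₂-prime}} p₂≡1)
...   | inj₂ p₂≡p₁ = ⊥-elim (p₁≢p₂ (sym p₂≡p₁))

distinct-primes-cancellable : ∀ {p₁ p₂ y} → Prime p₁ → Prime p₂ → p₁ ≢ p₂ → ¬ p₁ ∣ y → ¬ p₂ ∣ y →
                              Cancellable (p₁ * p₂) y
distinct-primes-cancellable {p₁} {p₂} p₁-prime p₂-prime p₁≢p₂ p₁∤y p₂∤y z h =
  distinct-primes-∣ p₁-prime p₂-prime p₁≢p₂ (prime-cancellable p₁-prime p₁∤y z (m*n∣⇒m∣ p₁ p₂ h))
                                            (prime-cancellable p₂-prime p₂∤y z (m*n∣⇒n∣ p₁ p₂ h))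

count-multiples : ∀ N a .{{_ : NonZero a}} → count (N * a) (λ x → does (a ∣? x)) ≡ N
count-multiples zero    a = refl
count-multiples (suc N) a = begin
  count (a + N * a) (λ x → does (a ∣? x))
    ≡⟨ count-+ a (N * a) (λ x → does (a ∣? x)) ⟩
  count a (λ x → does (a ∣? x)) + count (N * a) (λ x → does (a ∣? (a + x)))
    ≡⟨ cong₂ _+_ (trans (count-cong a only-zero) (count-point a 0 (>-nonZero⁻¹ a)))
                 (count-cong (N * a) λ x _ → does-agree (a ∣? (a + x)) (a ∣? x) (λ h → ∣m+n∣m⇒∣n h ∣-refl) (∣m∣n⇒∣m+n ∣-refl)) ⟩
  1 + count (N * a) (λ x → does (a ∣? x))
    ≡⟨ cong suc (count-multiples N a) ⟩
  suc N ∎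
  where
  open ≡-Reasoning
  only-zero : ∀ x → x < a → does (a ∣? x) ≡ (x ≡ᵇ 0)
  only-zero zero    _   = dec-true (a ∣? 0) (a ∣0)
  only-zero (suc x) x<a = dec-false (a ∣? suc x) (λ a∣ → <⇒≱ x<a (∣⇒≤ a∣))

÷-exact : ∀ a b K → 1 ≤ b → K * b ≡ a → a ÷ b ≡ K
÷-exact a (suc b) K _ refl = m*n/n≡m K (suc b)

pow-pred-split : ∀ a b → 2 ^ (a + b) ∸ 1 ≡ 2 ^ a * (2 ^ b ∸ 1) + (2 ^ a ∸ 1)
pow-pred-split a b = begin
  2 ^ (a + b) ∸ 1      ≡⟨ cong (_∸ 1) (^-distribˡ-+-* 2 a b) ⟩
  2 ^ a * 2 ^ b ∸ 1    ≡⟨ split (2 ^ a) (2 ^ b) (m^n>0 2 b) ⟩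
  2 ^ a * (2 ^ b ∸ 1) + (2 ^ a ∸ 1) ∎
  where
  open ≡-Reasoning
  split : ∀ A B → 1 ≤ B → A * B ∸ 1 ≡ A * (B ∸ 1) + (A ∸ 1)
  split zero    B       _ = refl
  split (suc a) (suc b) _ = ring a b
    where
    ring : ∀ a b → b + a * suc b ≡ (b + a * b) + a
    ring = solve-∀

∣pow-pred-multiple : ∀ {d} m k → d ∣ 2 ^ m ∸ 1 → d ∣ 2 ^ (k * m) ∸ 1
∣pow-pred-multiple     m zero    h = _ ∣0
∣pow-pred-multiple {d} m (suc k) h = subst (d ∣_) (sym (pow-pred-split m (k * m)))
  (∣m∣n⇒∣m+n (∣n⇒∣m*n (2 ^ m) (∣pow-pred-multiple m k h)) h)

ordSearch-spec : ∀ q j fuel s → j ≤ s → s < j + fuel → q ∣ 2 ^ s ∸ 1 →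
  let r = ordSearch q j fuel in
  j ≤ r × r < j + fuel × q ∣ 2 ^ r ∸ 1 × (∀ t → j ≤ t → t < r → ¬ q ∣ 2 ^ t ∸ 1)
ordSearch-spec q j zero s j≤s s<j _ = ⊥-elim (<-irrefl refl (<-≤-trans (subst (s <_) (+-identityʳ j) s<j) j≤s))
ordSearch-spec q j (suc fuel) s j≤s s<j+ h with q ∣? (2 ^ j ∸ 1)
... | yes q∣ = ≤-refl , m<m+n j z<s , q∣ , λ t j≤t t<j → ⊥-elim (<-irrefl refl (<-≤-trans t<j j≤t))
... | no q∤ with m≤n⇒m<n∨m≡n j≤s
...   | inj₂ refl = ⊥-elim (q∤ h)
...   | inj₁ j<s with ordSearch-spec q (suc j) fuel s j<s (subst (s <_) (+-suc j fuel) s<j+) h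
...     | j<r , r< , q∣r , below = <⇒≤ j<r , subst (ordSearch q (suc j) fuel <_) (sym (+-suc j fuel)) r< , q∣r , below′
  where
  below′ : ∀ t → j ≤ t → t < ordSearch q (suc j) fuel → ¬ q ∣ 2 ^ t ∸ 1
  below′ t j≤t t<r with m≤n⇒m<n∨m≡n j≤t
  ... | inj₂ refl = q∤
  ... | inj₁ j<t  = below t j<t t<r

module Order (d : ℕ) .{{_ : NonZero d}} (odd : ¬ 2 ∣ d) where

  -- Pigeonhole on 2⁰, …, 2^d modulo d gives 2^a ≡ 2^b with a < b ≤ d; cancel 2^a.
  order-exists : Σ ℕ λ s → 1 ≤ s × s ≤ d × d ∣ 2 ^ s ∸ 1
  order-exists with pigeonhole (n<1+n d) (λ (i : Fin (suc d)) → fromℕ< (m%n<n (2 ^ toℕ i) d))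
  ... | i , j , i<j , same-residue = toℕ j ∸ toℕ i , m<n⇒0<n∸m i<j ,
        ≤-trans (m∸n≤m (toℕ j) (toℕ i)) (≤-pred (toℕ<n j)) ,
        odd-cancel-pow odd a _ (subst (d ∣_) difference (≡-mod⇒∣∸ (2 ^ a) (2 ^ b) d residues))
    where
    a : ℕ
    a = toℕ i
    b : ℕ
    b = toℕ j
    residues : 2 ^ a % d ≡ 2 ^ b % d
    residues = trans (sym (toℕ-fromℕ< _)) (trans (cong toℕ same-residue) (toℕ-fromℕ< _))
    difference : 2 ^ b ∸ 2 ^ a ≡ 2 ^ a * (2 ^ (b ∸ a) ∸ 1)
    difference = begin
      2 ^ b ∸ 2 ^ a                   ≡⟨ cong (λ z → 2 ^ z ∸ 2 ^ a) (sym (m+[n∸m]≡n (<⇒≤ i<j))) ⟩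
      2 ^ (a + (b ∸ a)) ∸ 2 ^ a       ≡⟨ cong₂ _∸_ (^-distribˡ-+-* 2 a (b ∸ a)) (sym (*-identityʳ (2 ^ a))) ⟩
      2 ^ a * 2 ^ (b ∸ a) ∸ 2 ^ a * 1 ≡⟨ sym (*-distribˡ-∸ (2 ^ a) (2 ^ (b ∸ a)) 1) ⟩
      2 ^ a * (2 ^ (b ∸ a) ∸ 1)       ∎
      where open ≡-Reasoning

  private
    spec : 1 ≤ μ d × μ d < 1 + d × d ∣ 2 ^ μ d ∸ 1 × (∀ t → 1 ≤ t → t < μ d → ¬ d ∣ 2 ^ t ∸ 1)
    spec = let (s , 1≤s , s≤d , d∣) = order-exists in ordSearch-spec d 1 d s 1≤s (s≤s s≤d) d∣

  μ-positive : 1 ≤ μ d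
  μ-positive = proj₁ spec

  μ≤ : μ d ≤ d
  μ≤ = ≤-pred (proj₁ (proj₂ spec))

  ∣pow-μ : d ∣ 2 ^ μ d ∸ 1
  ∣pow-μ = proj₁ (proj₂ (proj₂ spec))

  μ-least : ∀ t → 1 ≤ t → t < μ d → ¬ d ∣ 2 ^ t ∸ 1
  μ-least = proj₂ (proj₂ (proj₂ spec))

  instance
    μ-nonZero : NonZero (μ d)
    μ-nonZero = >-nonZero μ-positive

  μ∣⇒∣pow : ∀ i → μ d ∣ i → d ∣ 2 ^ i ∸ 1
  μ∣⇒∣pow i (divides k refl) = ∣pow-pred-multiple (μ d) k ∣pow-μ

  ∣pow⇒μ∣ : ∀ i → d ∣ 2 ^ i ∸ 1 → μ d ∣ i
  ∣pow⇒μ∣ i h with i % μ d in rem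
  ... | zero  = m%n≡0⇒n∣m i (μ d) rem
  ... | suc r = ⊥-elim (μ-least (suc r) (s≤s z≤n) (subst (_< μ d) rem (m%n<n i (μ d))) d∣rem)
    where
    k : ℕ
    k = i / μ d
    i≡ : i ≡ suc r + k * μ d
    i≡ = trans (m≡m%n+[m/n]*n i (μ d)) (cong (_+ k * μ d) rem)
    d∣rem : d ∣ 2 ^ suc r ∸ 1
    d∣rem = ∣m+n∣m⇒∣n (subst (d ∣_) (trans (cong (λ e → 2 ^ e ∸ 1) i≡) (pow-pred-split (suc r) (k * μ d))) h)
                      (∣n⇒∣m*n (2 ^ suc r) (∣pow-pred-multiple (μ d) k ∣pow-μ))

module Doubling (p : ℕ) .{{_ : NonZero p}} where

  double : ℕ → ℕ
  double x = (2 * x) % p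

  double<p : ∀ x → double x < p
  double<p x = m%n<n (2 * x) p

  orbitMin : ℕ → Bool
  orbitMin = isOrbitMin double p

  iter-double : ∀ i x → x < p → iter double i x ≡ (2 ^ i * x) % p
  iter-double zero    x x<p = sym (trans (cong (_% p) (+-identityʳ x)) (m<n⇒m%n≡m x<p))
  iter-double (suc i) x x<p = begin
    (2 * iter double i x) % p       ≡⟨ cong (λ y → (2 * y) % p) (iter-double i x x<p) ⟩
    (2 * ((2 ^ i * x) % p)) % p     ≡⟨ %-distribˡ-* 2 ((2 ^ i * x) % p) p ⟩
    (2 % p * ((2 ^ i * x) % p % p)) % p ≡⟨ cong (λ y → (2 % p * y) % p) (m%n%n≡m%n (2 ^ i * x) p) ⟩
    (2 % p * ((2 ^ i * x) % p)) % p ≡⟨ sym (%-distribˡ-* 2 (2 ^ i * x) p) ⟩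
    (2 * (2 ^ i * x)) % p           ≡⟨ cong (_% p) (sym (*-assoc 2 (2 ^ i) x)) ⟩
    (2 ^ suc i * x) % p             ∎
    where open ≡-Reasoning

  private
    pow-times-pred : ∀ i x → 2 ^ i * x ∸ x ≡ (2 ^ i ∸ 1) * x
    pow-times-pred i x = trans (cong (2 ^ i * x ∸_) (sym (*-identityˡ x))) (sym (*-distribʳ-∸ x (2 ^ i) 1))

  fixed⇒∣ : ∀ i x → x < p → iter double i x ≡ x → p ∣ (2 ^ i ∸ 1) * x
  fixed⇒∣ i x x<p fixed = subst (p ∣_) (pow-times-pred i x)
    (≡-mod⇒∣∸ x (2 ^ i * x) p (trans (m<n⇒m%n≡m x<p) (trans (sym fixed) (iter-double i x x<p))))

  ∣⇒fixed : ∀ i x → x < p → p ∣ (2 ^ i ∸ 1) * x → iter double i x ≡ x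
  ∣⇒fixed i x x<p p∣ = begin
    iter double i x               ≡⟨ iter-double i x x<p ⟩
    (2 ^ i * x) % p               ≡⟨ cong (_% p) (sym (m∸n+n≡m (m≤n*m x (2 ^ i)))) ⟩
    ((2 ^ i * x ∸ x) + x) % p     ≡⟨ %-remove-+ˡ x (subst (p ∣_) (sym (pow-times-pred i x)) p∣) ⟩
    x % p                         ≡⟨ m<n⇒m%n≡m x<p ⟩
    x                             ∎
    where
    open ≡-Reasoning
    instance
      2^i-nonZero : NonZero (2 ^ i)
      2^i-nonZero = m^n≢0 2 i

  ∣double⇒∣ : ∀ D x → D ∣ p → ¬ 2 ∣ D → D ∣ double x → D ∣ x
  ∣double⇒∣ D x D∣p odd h = odd-cancel odd x (∣n∣m%n⇒∣m D∣p h)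

  ∣⇒∣double : ∀ D x → D ∣ p → D ∣ x → D ∣ double x
  ∣⇒∣double D x D∣p h = %-presˡ-∣ (∣n⇒∣m*n 2 h) D∣p

  module Class (e d : ℕ) .{{_ : NonZero d}} (odd : ¬ 2 ∣ d) (p≡ : p ≡ e * d) (S : ℕ → Bool)
               (S-closed : ∀ x → x < p → T (S x) → T (S (double x)))
               (S-shape : ∀ x → x < p → T (S x) → Σ ℕ λ y → x ≡ e * y × Cancellable d y) where
    open Order d odd

    private
      instance
        e-nonZero : NonZero e
        e-nonZero = ≢-nonZero λ { refl → ≢-nonZero⁻¹ p p≡ }

      expand : ∀ i y → (2 ^ i ∸ 1) * (e * y) ≡ e * ((2 ^ i ∸ 1) * y)
      expand i y = ring (2 ^ i ∸ 1) e y
        where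
        ring : ∀ a e y → a * (e * y) ≡ e * (a * y)
        ring = solve-∀

    fixed⇔μ∣ : ∀ x → x < p → T (S x) → ∀ i → (iter double i x ≡ x → μ d ∣ i) × (μ d ∣ i → iter double i x ≡ x)
    fixed⇔μ∣ x x<p Sx i with S-shape x x<p Sx
    ... | y , refl , y-invertible =
      (λ fixed → ∣pow⇒μ∣ i (y-invertible _ (*-cancelˡ-∣ e (subst₂ _∣_ p≡ (expand i y) (fixed⇒∣ i (e * y) x<p fixed))))) ,
      (λ μ∣i → ∣⇒fixed i (e * y) x<p (subst₂ _∣_ (sym p≡) (sym (expand i y)) (*-monoʳ-∣ e (∣m⇒∣m*n y (μ∣⇒∣pow i μ∣i)))))

    exact : ExactPeriod p double (μ d) S
    exact = record
      { closed          = λ x x<p Sx → double<p x , S-closed x x<p Sx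
      ; periodic        = λ x x<p Sx → proj₂ (fixed⇔μ∣ x x<p Sx (μ d)) ∣-refl
      ; noShorterPeriod = λ x x<p Sx i 0<i i<μ fixed →
          <⇒≱ i<μ (∣⇒≤ {{>-nonZero 0<i}} (proj₁ (fixed⇔μ∣ x x<p Sx i) fixed)) }

    class-count : count p (λ x → orbitMin x ∧ S x) * μ d ≡ count p S
    class-count = orbit-count μ-positive (≤-trans μ≤ (subst (d ≤_) (trans (*-comm d e) (sym p≡)) (m≤m*n d e))) S exact

-- Shifting by one, j ↦ j + 1 conjugates
-- τ(j) = 2j + 1 mod p on {0, …, p-2} to doubling on the nonzero residues {1, …, p-1},
-- so the cycles of τ are counted by the orbit minima among nonzero residues.
module Cycles (n : ℕ) (odd : ¬ 2 ∣ suc n) where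
  p : ℕ
  p = suc n
  open Doubling p public

  nonzero : ℕ → Bool
  nonzero x = not (does (p ∣? x))

  τ-conjugate : ∀ y → y < n → suc (τ p y) ≡ double (suc y) × τ p y < n
  τ-conjugate y y<n = trans (sym shifted) (cong (_% p) (sym (2[1+y] y))) , r<n
    where
    2[1+y] : ∀ y → 2 * suc y ≡ suc (2 * y + 1)
    2[1+y] = solve-∀
    m : ℕ
    m = 2 * y + 1
    r : ℕ
    r = m % p
    m≡ : m ≡ r + m / p * p
    m≡ = m≡m%n+[m/n]*n m p
    -- r = p - 1 would make p ∣ 2(y + 1), impossible for odd p and 0 < y + 1 < p.
    r≢n : r ≢ n
    r≢n r≡n = <⇒≱ (s≤s y<n) (∣⇒≤ (odd-cancel odd (suc y) (subst (p ∣_) (sym (2[1+y] y)) p∣)))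
      where
      p∣ : p ∣ suc m
      p∣ = divides (suc (m / p)) (trans (cong suc m≡) (cong (λ z → suc z + m / p * p) r≡n))
    r<n : r < n
    r<n with m≤n⇒m<n∨m≡n (≤-pred (m%n<n m p))
    ... | inj₁ r<n = r<n
    ... | inj₂ r≡n = ⊥-elim (r≢n r≡n)
    shifted : suc m % p ≡ suc r
    shifted = trans (cong (λ z → suc z % p) m≡) (trans ([m+kn]%n≡m%n (suc r) (m / p) p) (m<n⇒m%n≡m (s≤s r<n)))

  τ-iter-conjugate : ∀ j → j < n → ∀ i → suc (τ^ p i j) ≡ iter double i (suc j) × τ^ p i j < n
  τ-iter-conjugate j j<n zero    = refl , j<n
  τ-iter-conjugate j j<n (suc i) =
    let (e , lt) = τ-iter-conjugate j j<n i ; (e′ , lt′) = τ-conjugate (τ^ p i j) lt in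
    trans e′ (cong double e) , lt′

  cycleMin-conjugate : ∀ j → j < n → isCycleMin p j ≡ orbitMin (suc j)
  cycleMin-conjugate j j<n = cong and (map-cong pointwise (upTo p))
    where
    pointwise : ∀ i → (j ≤ᵇ τ^ p i j) ≡ (suc j ≤ᵇ iter double i (suc j))
    pointwise i = trans (≤ᵇ-suc j (τ^ p i j)) (cong (suc j ≤ᵇ_) (proj₁ (τ-iter-conjugate j j<n i)))
      where
      ≤ᵇ-suc : ∀ a b → (a ≤ᵇ b) ≡ (suc a ≤ᵇ suc b)
      ≤ᵇ-suc a b = T-ext (λ h → ≤⇒≤ᵇ (s≤s (≤ᵇ⇒≤ a b h))) (λ h → ≤⇒≤ᵇ (s≤s⁻¹ (≤ᵇ⇒≤ (suc a) (suc b) h)))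

  cycles-as-orbits : numCycles p ≡ count p (λ x → orbitMin x ∧ nonzero x)
  cycles-as-orbits = begin
    numCycles p
      ≡⟨ length-filter n (isCycleMin p) ⟩
    count n (isCycleMin p)
      ≡⟨ count-cong n (λ j j<n → trans (cycleMin-conjugate j j<n) (sym (∧-identityʳ _))) ⟩
    count n (λ j → orbitMin (suc j) ∧ true)
      ≡⟨ count-cong n (λ j j<n → cong (orbitMin (suc j) ∧_) (sym (suc-nonzero j j<n))) ⟩
    count n (λ j → orbitMin (suc j) ∧ nonzero (suc j))
      ≡⟨ cong (_+ count n (λ j → orbitMin (suc j) ∧ nonzero (suc j))) (sym zero-excluded) ⟩
    count p (λ x → orbitMin x ∧ nonzero x) ∎
    where
    open ≡-Reasoning
    length-filter : ∀ n P → length (filterᵇ P (upTo n)) ≡ count n P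
    length-filter n P = go n P id
      where
      go : ∀ n P g → length (filterᵇ P (applyUpTo g n)) ≡ count n (P ∘ g)
      go zero    P g = refl
      go (suc n) P g with P (g 0)
      ... | true  = cong suc (go n P (g ∘ suc))
      ... | false = go n P (g ∘ suc)
    suc-nonzero : ∀ j → j < n → nonzero (suc j) ≡ true
    suc-nonzero j j<n = cong not (dec-false (p ∣? suc j) (λ p∣ → <⇒≱ (s≤s j<n) (∣⇒≤ p∣)))
    zero-excluded : ind (orbitMin 0 ∧ nonzero 0) ≡ 0
    zero-excluded = cong ind (trans (cong (λ b → orbitMin 0 ∧ not b) (dec-true (p ∣? 0) (p ∣0))) (∧-zeroʳ _))

binomial-second-order : ∀ u n → Σ ℕ λ C → Σ ℕ λ E → (1 + u) ^ n ≡ 1 + n * u + u * u * C × 2 * C + n ≡ n * n + u * E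
binomial-second-order u zero    = 0 , 0 , base u , base′ u
  where
  base : ∀ u → 1 ≡ 1 + 0 * u + u * u * 0
  base = solve-∀
  base′ : ∀ u → 2 * 0 + 0 ≡ 0 * 0 + u * 0
  base′ = solve-∀
binomial-second-order u (suc n) with binomial-second-order u n
... | C , E , expand , congruence =
  C + n + u * C , E + 2 * C ,
  trans (cong ((1 + u) *_) expand) (step u n C) ,
  trans (regroup u n C) (trans (cong (_+ (2 * n + 1 + 2 * u * C)) congruence) (regroup′ u n C E))
  where
  step : ∀ u n C → (1 + u) * (1 + n * u + u * u * C) ≡ 1 + suc n * u + u * u * (C + n + u * C)
  step = solve-∀
  regroup : ∀ u n C → 2 * (C + n + u * C) + suc n ≡ (2 * C + n) + (2 * n + 1 + 2 * u * C)
  regroup = solve-∀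
  regroup′ : ∀ u n C E → (n * n + u * E) + (2 * n + 1 + 2 * u * C) ≡ suc n * suc n + u * (E + 2 * C)
  regroup′ = solve-∀

Exactly : ℕ → ℕ → ℕ → Set
Exactly q k N = q ^ k ∣ N × ¬ q ^ suc k ∣ N

module LiftingTheExponent (q : ℕ) (q-prime : Prime q) (q-odd : ¬ 2 ∣ q) where
  private
    instance
      q-nonZero : NonZero q
      q-nonZero = prime⇒nonZero q-prime

  -- q divides the second-order coefficient C of (1 + u)^q when q ∣ u, as q is odd.
  q∣second-order : ∀ u C E → q ∣ u → 2 * C + q ≡ q * q + u * E → q ∣ C
  q∣second-order u C E q∣u congruence = odd-cancel q-odd C
    (∣m+n∣m⇒∣n (subst (q ∣_) (trans (sym congruence) (+-comm (2 * C) q)) (∣m∣n⇒∣m+n (m∣m*n q) (∣m⇒∣m*n E q∣u))) ∣-refl)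

  -- If q^(c+1) exactly divides X - 1, then q^(c+2) exactly divides X^q - 1:
  -- writing X - 1 = t·q^(c+1) with q ∤ t, one finds X^q - 1 = q^(c+2)·(t + q·k).
  lift : ∀ c X → 1 ≤ X → Exactly q (suc c) (X ∸ 1) → Exactly q (suc (suc c)) (X ^ q ∸ 1)
  lift c X 1≤X (divides t u≡ , q^c+2∤u) with binomial-second-order (X ∸ 1) q
  ... | C , E , expand , congruence with q∣second-order (X ∸ 1) C E (subst (q ∣_) (sym u≡) (∣n⇒∣m*n t (m∣m*n (q ^ c)))) congruence
  ...   | divides w refl = divides (t + q * k) (trans Xq-1≡ (*-comm (q ^ suc (suc c)) _)) , q^c+3∤
    where
    u : ℕ
    u = X ∸ 1
    k : ℕ
    k = t * t * w * q ^ c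
    factor : ∀ q t w Qc → q * (t * (q * Qc)) + t * (q * Qc) * (t * (q * Qc)) * (w * q) ≡ q * (q * Qc) * (t + q * (t * t * w * Qc))
    factor = solve-∀
    Xq-1≡ : X ^ q ∸ 1 ≡ q ^ suc (suc c) * (t + q * k)
    Xq-1≡ = begin
      X ^ q ∸ 1                         ≡⟨ cong (λ z → z ^ q ∸ 1) (sym (m+[n∸m]≡n 1≤X)) ⟩
      (1 + u) ^ q ∸ 1                   ≡⟨ cong (_∸ 1) expand ⟩
      1 + q * u + u * u * (w * q) ∸ 1   ≡⟨ cong (_∸ 1) (+-assoc 1 (q * u) _) ⟩
      q * u + u * u * (w * q)           ≡⟨ cong (λ u → q * u + u * u * (w * q)) u≡ ⟩
      q * (t * (q * q ^ c)) + t * (q * q ^ c) * (t * (q * q ^ c)) * (w * q) ≡⟨ factor q t w (q ^ c) ⟩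
      q ^ suc (suc c) * (t + q * k)     ∎
      where open ≡-Reasoning
    q∤t : ¬ q ∣ t
    q∤t (divides s refl) = q^c+2∤u (subst (q ^ suc (suc c) ∣_) (sym u≡) (divides s (reassoc s q (q ^ c))))
      where
      reassoc : ∀ s q Qc → s * q * (q * Qc) ≡ s * (q * (q * Qc))
      reassoc = solve-∀
    q^c+3∤ : ¬ q ^ suc (suc (suc c)) ∣ X ^ q ∸ 1
    q^c+3∤ h = q∤t (∣m+n∣m⇒∣n (subst (q ∣_) (+-comm t (q * k)) q∣t+qk) (m∣m*n k))
      where
      instance
        q^c+2-nonZero : NonZero (q ^ suc (suc c))
        q^c+2-nonZero = m^n≢0 q (suc (suc c))
      q∣t+qk : q ∣ t + q * k
      q∣t+qk = *-cancelˡ-∣ (q ^ suc (suc c)) (subst₂ _∣_ (*-comm q _) Xq-1≡ h)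

  module PrimePowerOrder (hyp : μ (q ^ 2) ≡ μ q * q) where
    module Oq = Order q q-odd
    module O (n : ℕ) = Order (q ^ n) {{m^n≢0 q n}} (odd-pow q-odd n)

    expected : ℕ → ℕ
    expected c = μ q * q ^ c

    private
      expected-nonZero : ∀ c → NonZero (expected c)
      expected-nonZero c = m*n≢0 (μ q) (q ^ c) {{Oq.μ-nonZero}} {{m^n≢0 q c}}

      swap : ∀ a b c → a * (b * c) ≡ b * (a * c)
      swap = solve-∀

    -- q^(c+1) exactly divides 2^(μ(q) q^c) - 1: the base case is the hypothesis,
    -- the inductive step is the lifting lemma.
    exact-valuation : ∀ c → Exactly q (suc c) (2 ^ expected c ∸ 1)
    exact-valuation zero = subst₂ (λ a b → a ∣ 2 ^ b ∸ 1) (sym (*-identityʳ q)) (sym (*-identityʳ (μ q))) Oq.∣pow-μ , q²∤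
      where
      q²∤ : ¬ q ^ 2 ∣ 2 ^ (μ q * 1) ∸ 1
      q²∤ h = <⇒≱ (*-monoʳ-< (μ q) 1<q) (subst (_≤ μ q * 1) hyp (∣⇒≤ {{expected-nonZero 0}} (O.∣pow⇒μ∣ 2 (μ q * 1) h)))
        where
        1<q : 1 < q
        1<q = nonTrivial⇒n>1 q {{prime⇒nonTrivial q-prime}}
    exact-valuation (suc c) =
      subst (λ N → Exactly q (suc (suc c)) (N ∸ 1)) raise (lift c (2 ^ expected c) (m^n>0 2 (expected c)) (exact-valuation c))
      where
      raise : (2 ^ expected c) ^ q ≡ 2 ^ expected (suc c)
      raise = trans (^-*-assoc 2 (expected c) q) (cong (2 ^_) (trans (*-assoc (μ q) (q ^ c) q) (cong (μ q *_) (*-comm (q ^ c) q))))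

    -- μ(q^(c+2)) is a multiple r·μ(q^(c+1)) dividing q·μ(q^(c+1)); r = 1 is excluded
    -- by the exact valuation, so r = q.
    μ-prime-power : ∀ c → μ (q ^ suc c) ≡ expected c
    μ-prime-power zero    = trans (cong μ (*-identityʳ q)) (sym (*-identityʳ (μ q)))
    μ-prime-power (suc c) with subst (_∣ μ (q ^ suc (suc c))) (μ-prime-power c)
                                 (O.∣pow⇒μ∣ (suc c) _ (∣-trans (n∣m*n q) (O.∣pow-μ (suc (suc c)))))
    ... | divides r M≡ with prime⇒irreducible q-prime r∣q
      where
      r∣q : r ∣ q
      r∣q = *-cancelʳ-∣ (expected c) {{expected-nonZero c}} (subst₂ _∣_ M≡ (swap (μ q) q (q ^ c))
              (O.∣pow⇒μ∣ (suc (suc c)) (expected (suc c)) (proj₁ (exact-valuation (suc c)))))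
    ...   | inj₁ refl = ⊥-elim (proj₂ (exact-valuation c)
              (subst (λ e → q ^ suc (suc c) ∣ 2 ^ e ∸ 1) (trans M≡ (*-identityˡ (expected c))) (O.∣pow-μ (suc (suc c)))))
    ...   | inj₂ refl = trans M≡ (sym (swap (μ q) q (q ^ c)))

-- The nonzero residues split into layers by exact q-adic
-- valuation a < ℓ; layer a has (q - 1)·q^c elements (a + c + 1 = ℓ) and doubling acts
-- on it with period μ(q^(c+1)) = μ(q)·q^c, so every layer has (q - 1)/μ(q) orbits.
module PrimePower (n : ℕ) (p-odd : ¬ 2 ∣ suc n) (q ℓ : ℕ) (q-prime : Prime q) (hyp : μ (q ^ 2) ≡ μ q * q)
                  (1≤ℓ : 1 ≤ ℓ) (p≡ : suc n ≡ q ^ ℓ) where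
  open Cycles n p-odd

  q-odd : ¬ 2 ∣ q
  q-odd 2∣q = p-odd (subst (2 ∣_) (sym p≡) (∣-trans 2∣q (q∣q^ℓ 1≤ℓ)))
    where
    q∣q^ℓ : ∀ {ℓ} → 1 ≤ ℓ → q ∣ q ^ ℓ
    q∣q^ℓ {suc ℓ} _ = m∣m*n (q ^ ℓ)

  open LiftingTheExponent q q-prime q-odd
  open PrimePowerOrder hyp

  instance
    q-nonZero : NonZero q
    q-nonZero = prime⇒nonZero q-prime

  K : ℕ
  K = (q ∸ 1) ÷ μ q

  multipleOf : ℕ → ℕ → Bool
  multipleOf a x = does (q ^ a ∣? x)

  layer : ℕ → ℕ → Bool
  layer a x = multipleOf a x ∧ not (multipleOf (suc a) x)

  multipleOf-suc : ∀ a x → T (multipleOf (suc a) x) → T (multipleOf a x)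
  multipleOf-suc a x h = ⇒does (q ^ a ∣? x) (∣-trans (n∣m*n q) (does⇒ (q ^ suc a ∣? x) h))

  module Layer (a c : ℕ) (a+c+1≡ℓ : a + suc c ≡ ℓ) where
    private
      instance
        q^a-nonZero : NonZero (q ^ a)
        q^a-nonZero = m^n≢0 q a
        q^a+1-nonZero : NonZero (q ^ suc a)
        q^a+1-nonZero = m^n≢0 q (suc a)
        q^c-nonZero : NonZero (q ^ c)
        q^c-nonZero = m^n≢0 q c
        q^c+1-nonZero : NonZero (q ^ suc c)
        q^c+1-nonZero = m^n≢0 q (suc c)

      p≡q^a*q^c+1 : p ≡ q ^ a * q ^ suc c
      p≡q^a*q^c+1 = trans p≡ (trans (cong (q ^_) (sym a+c+1≡ℓ)) (^-distribˡ-+-* q a (suc c)))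

      p≡q^c*q^a+1 : p ≡ q ^ c * q ^ suc a
      p≡q^c*q^a+1 = trans p≡q^a*q^c+1 (ring q (q ^ a) (q ^ c))
        where
        ring : ∀ q A C → A * (q * C) ≡ C * (q * A)
        ring = solve-∀

      q^a∣p : q ^ a ∣ p
      q^a∣p = subst (q ^ a ∣_) (sym p≡q^a*q^c+1) (m∣m*n (q ^ suc c))

      q^a+1∣p : q ^ suc a ∣ p
      q^a+1∣p = subst (q ^ suc a ∣_) (sym p≡q^c*q^a+1) (n∣m*n (q ^ c))

    closed : ∀ x → x < p → T (layer a x) → T (layer a (double x))
    closed x _ h with difference⁻ (q ^ a ∣? x) (q ^ suc a ∣? x) h
    ... | q^a∣x , q^a+1∤x = difference⁺ (q ^ a ∣? double x) (q ^ suc a ∣? double x)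
      (∣⇒∣double (q ^ a) x q^a∣p q^a∣x)
      (λ q^a+1∣2x → q^a+1∤x (∣double⇒∣ (q ^ suc a) x q^a+1∣p (odd-pow q-odd (suc a)) q^a+1∣2x))

    shape : ∀ x → x < p → T (layer a x) → Σ ℕ λ y → x ≡ q ^ a * y × Cancellable (q ^ suc c) y
    shape x _ h with difference⁻ (q ^ a ∣? x) (q ^ suc a ∣? x) h
    ... | divides y refl , q^a+1∤x = y , *-comm y (q ^ a) , prime-power-cancellable q-prime q∤y (suc c)
      where
      q∤y : ¬ q ∣ y
      q∤y (divides s refl) = q^a+1∤x (divides s (*-assoc s q (q ^ a)))

    size : count p (layer a) ≡ (q ∸ 1) * q ^ c
    size = begin
      count p (layer a)                                        ≡⟨ sym (m+n∸n≡m _ (q ^ c)) ⟩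
      count p (layer a) + q ^ c ∸ q ^ c                        ≡⟨ cong (λ N → count p (layer a) + N ∸ q ^ c) (sym multiples-a+1) ⟩
      count p (layer a) + count p (multipleOf (suc a)) ∸ q ^ c ≡⟨ cong (_∸ q ^ c) (sym layers) ⟩
      count p (multipleOf a) ∸ q ^ c                           ≡⟨ cong₂ _∸_ multiples-a (sym (*-identityˡ (q ^ c))) ⟩
      q * q ^ c ∸ 1 * q ^ c                                    ≡⟨ sym (*-distribʳ-∸ (q ^ c) q 1) ⟩
      (q ∸ 1) * q ^ c                                          ∎
      where
      open ≡-Reasoning
      layers : count p (multipleOf a) ≡ count p (layer a) + count p (multipleOf (suc a))
      layers = count-split p (λ _ → true) (multipleOf a) (layer a) (multipleOf (suc a))
                 (λ x _ → ind-complement (multipleOf a x) (multipleOf (suc a) x) (multipleOf-suc a x))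
      multiples-a : count p (multipleOf a) ≡ q ^ suc c
      multiples-a = trans (cong (λ N → count N (multipleOf a)) (trans p≡q^a*q^c+1 (*-comm (q ^ a) _))) (count-multiples (q ^ suc c) (q ^ a))
      multiples-a+1 : count p (multipleOf (suc a)) ≡ q ^ c
      multiples-a+1 = trans (cong (λ N → count N (multipleOf (suc a))) p≡q^c*q^a+1) (count-multiples (q ^ c) (q ^ suc a))

    open Class (q ^ a) (q ^ suc c) (odd-pow q-odd (suc c)) p≡q^a*q^c+1 (layer a) closed shape

    -- Orbits: count · μ(q) q^c = (q - 1) q^c, so count = (q - 1)/μ(q).
    orbits : count p (λ x → orbitMin x ∧ layer a x) ≡ K
    orbits = sym (÷-exact (q ∸ 1) (μ q) N Oq.μ-positive (*-cancelʳ-≡ (N * μ q) (q ∸ 1) (q ^ c) (begin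
      N * μ q * q ^ c   ≡⟨ *-assoc N (μ q) (q ^ c) ⟩
      N * expected c    ≡⟨ cong (N *_) (sym (μ-prime-power c)) ⟩
      N * μ (q ^ suc c) ≡⟨ class-count ⟩
      count p (layer a) ≡⟨ size ⟩
      (q ∸ 1) * q ^ c   ∎)))
      where
      open ≡-Reasoning
      N : ℕ
      N = count p (λ x → orbitMin x ∧ layer a x)

  telescope : ∀ j a → a + j ≡ ℓ →
    count p (λ x → orbitMin x ∧ multipleOf a x) ≡ j * K + count p (λ x → orbitMin x ∧ multipleOf ℓ x)
  telescope zero    a a+0≡ℓ = cong (λ b → count p (λ x → orbitMin x ∧ multipleOf b x)) (trans (sym (+-identityʳ a)) a+0≡ℓ)
  telescope (suc j) a a+j+1≡ℓ = begin
    count p (λ x → orbitMin x ∧ multipleOf a x)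
      ≡⟨ count-split p orbitMin (multipleOf a) (layer a) (multipleOf (suc a))
           (λ x _ → ind-complement (multipleOf a x) (multipleOf (suc a) x) (multipleOf-suc a x)) ⟩
    count p (λ x → orbitMin x ∧ layer a x) + count p (λ x → orbitMin x ∧ multipleOf (suc a) x)
      ≡⟨ cong₂ _+_ (Layer.orbits a j a+j+1≡ℓ) (telescope j (suc a) (trans (sym (+-suc a j)) a+j+1≡ℓ)) ⟩
    K + (j * K + count p (λ x → orbitMin x ∧ multipleOf ℓ x))
      ≡⟨ sym (+-assoc K (j * K) _) ⟩
    suc j * K + count p (λ x → orbitMin x ∧ multipleOf ℓ x) ∎
    where open ≡-Reasoning

  cycles : numCycles p ≡ K * ℓ
  cycles = +-cancelʳ-≡ Z (numCycles p) (K * ℓ) (begin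
    numCycles p + Z                              ≡⟨ cong (_+ Z) cycles-as-orbits ⟩
    count p (λ x → orbitMin x ∧ nonzero x) + Z   ≡⟨ sym (count-split p orbitMin (multipleOf 0) nonzero (multipleOf ℓ) everything) ⟩
    count p (λ x → orbitMin x ∧ multipleOf 0 x)  ≡⟨ telescope ℓ 0 refl ⟩
    ℓ * K + Z                                    ≡⟨ cong (_+ Z) (*-comm ℓ K) ⟩
    K * ℓ + Z                                    ∎)
    where
    open ≡-Reasoning
    -- The orbit minima among multiples of p, cancelled from both sides.
    Z : ℕ
    Z = count p (λ x → orbitMin x ∧ multipleOf ℓ x)
    -- Every residue is a multiple of q⁰, and is either nonzero or a multiple of q^ℓ = p.
    everything : ∀ x → x < p → ind (multipleOf 0 x) ≡ ind (nonzero x) + ind (multipleOf ℓ x)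
    everything x _ = begin
      ind (multipleOf 0 x)                            ≡⟨ cong ind (dec-true (1 ∣? x) (1∣ x)) ⟩
      ind true                                        ≡⟨ ind-complement true (multipleOf ℓ x) _ ⟩
      ind (not (multipleOf ℓ x)) + ind (multipleOf ℓ x) ≡⟨ cong (λ b → ind (not b) + ind (multipleOf ℓ x)) (does-agree (q ^ ℓ ∣? x) (p ∣? x) (subst (_∣ x) (sym p≡)) (subst (_∣ x) p≡)) ⟩
      ind (nonzero x) + ind (multipleOf ℓ x)          ∎

-- The nonzero residues split into the
-- nonzero multiples of p₁ (p₂ - 1 of them, period μ(p₂)), the nonzero multiples of p₂
-- (p₁ - 1 of them, period μ(p₁)) and the units ((p₁ - 1)(p₂ - 1) of them, period
-- μ(p) = lcm(μ(p₁), μ(p₂))).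
module TwoPrimes (n : ℕ) (p-odd : ¬ 2 ∣ suc n) (p₁ p₂ : ℕ) (p₁-prime : Prime p₁) (p₂-prime : Prime p₂)
                 (p₁≢p₂ : p₁ ≢ p₂) (p≡ : suc n ≡ p₁ * p₂) where
  open Cycles n p-odd

  instance
    p₁-nonZero : NonZero p₁
    p₁-nonZero = prime⇒nonZero p₁-prime
    p₂-nonZero : NonZero p₂
    p₂-nonZero = prime⇒nonZero p₂-prime

  p≡p₂*p₁ : p ≡ p₂ * p₁
  p≡p₂*p₁ = trans p≡ (*-comm p₁ p₂)

  count-multiples-of-p : count p (λ x → does (p ∣? x)) ≡ 1
  count-multiples-of-p = trans (cong (λ N → count N (λ x → does (p ∣? x))) (sym (*-identityˡ p))) (count-multiples 1 p)

  module Multiples (r s : ℕ) (r-prime : Prime r) (s-prime : Prime s) (p≡r*s : p ≡ r * s) where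
    private
      instance
        r-nonZero : NonZero r
        r-nonZero = prime⇒nonZero r-prime
        s-nonZero : NonZero s
        s-nonZero = prime⇒nonZero s-prime

      r∣p : r ∣ p
      r∣p = subst (r ∣_) (sym p≡r*s) (m∣m*n s)

      s-odd : ¬ 2 ∣ s
      s-odd 2∣s = p-odd (subst (2 ∣_) (sym p≡r*s) (∣n⇒∣m*n r 2∣s))

    multiple : ℕ → Bool
    multiple x = does (r ∣? x) ∧ not (does (p ∣? x))

    closed : ∀ x → x < p → T (multiple x) → T (multiple (double x))
    closed x _ h with difference⁻ (r ∣? x) (p ∣? x) h
    ... | r∣x , p∤x = difference⁺ (r ∣? double x) (p ∣? double x) (∣⇒∣double r x r∣p r∣x)
                                  (λ p∣2x → p∤x (∣double⇒∣ p x ∣-refl p-odd p∣2x))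

    shape : ∀ x → x < p → T (multiple x) → Σ ℕ λ y → x ≡ r * y × Cancellable s y
    shape x _ h with difference⁻ (r ∣? x) (p ∣? x) h
    ... | divides y refl , p∤x = y , *-comm y r , prime-cancellable s-prime s∤y
      where
      s∤y : ¬ s ∣ y
      s∤y (divides t refl) = p∤x (subst (_∣ t * s * r) (sym p≡r*s) (divides t (reassoc t s r)))
        where
        reassoc : ∀ t s r → t * s * r ≡ t * (r * s)
        reassoc = solve-∀

    -- The s multiples of r below p are the s - 1 nonzero ones together with 0.
    size : 1 + count p multiple ≡ s
    size = begin
      1 + count p multiple                              ≡⟨ +-comm 1 _ ⟩
      count p multiple + 1                              ≡⟨ cong (count p multiple +_) (sym count-multiples-of-p) ⟩
      count p multiple + count p (λ x → does (p ∣? x))  ≡⟨ sym (count-split p (λ _ → true) (λ x → does (r ∣? x)) multiple (λ x → does (p ∣? x))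
                                                             (λ x _ → ind-complement (does (r ∣? x)) _ (λ p∣ → ⇒does (r ∣? x) (∣-trans r∣p (does⇒ (p ∣? x) p∣))))) ⟩
      count p (λ x → does (r ∣? x))                     ≡⟨ cong (λ N → count N (λ x → does (r ∣? x))) (trans p≡r*s (*-comm r s)) ⟩
      count (s * r) (λ x → does (r ∣? x))               ≡⟨ count-multiples s r ⟩
      s                                                 ∎
      where open ≡-Reasoning

    open Class r s s-odd p≡r*s multiple closed shape

    orbits : count p (λ x → orbitMin x ∧ multiple x) ≡ (s ∸ 1) ÷ μ s
    orbits = sym (÷-exact (s ∸ 1) (μ s) (count p (λ x → orbitMin x ∧ multiple x)) (Order.μ-positive s s-odd)
                          (trans class-count (cong (_∸ 1) size)))

  module M₁ = Multiples p₁ p₂ p₁-prime p₂-prime p≡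
  module M₂ = Multiples p₂ p₁ p₂-prime p₁-prime p≡p₂*p₁

  unit : ℕ → Bool
  unit x = not (does (p₁ ∣? x)) ∧ not (does (p₂ ∣? x))

  private
    p₁-odd : ¬ 2 ∣ p₁
    p₁-odd 2∣p₁ = p-odd (subst (2 ∣_) (sym p≡) (∣m⇒∣m*n p₂ 2∣p₁))

    p₂-odd : ¬ 2 ∣ p₂
    p₂-odd 2∣p₂ = p-odd (subst (2 ∣_) (sym p≡) (∣n⇒∣m*n p₁ 2∣p₂))

    p₁∣p : p₁ ∣ p
    p₁∣p = subst (p₁ ∣_) (sym p≡) (m∣m*n p₂)

    p₂∣p : p₂ ∣ p
    p₂∣p = subst (p₂ ∣_) (sym p≡) (n∣m*n p₁)

  unit-closed : ∀ x → x < p → T (unit x) → T (unit (double x))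
  unit-closed x _ h with neither⁻ (p₁ ∣? x) (p₂ ∣? x) h
  ... | p₁∤x , p₂∤x = neither⁺ (p₁ ∣? double x) (p₂ ∣? double x)
                        (λ p₁∣ → p₁∤x (∣double⇒∣ p₁ x p₁∣p p₁-odd p₁∣)) (λ p₂∣ → p₂∤x (∣double⇒∣ p₂ x p₂∣p p₂-odd p₂∣))

  unit-shape : ∀ x → x < p → T (unit x) → Σ ℕ λ y → x ≡ 1 * y × Cancellable p y
  unit-shape x _ h with neither⁻ (p₁ ∣? x) (p₂ ∣? x) h
  ... | p₁∤x , p₂∤x = x , sym (*-identityˡ x) ,
        subst (λ d → Cancellable d x) (sym p≡) (distinct-primes-cancellable p₁-prime p₂-prime p₁≢p₂ p₁∤x p₂∤x)

  -- 2^i ≡ 1 modulo p₁p₂ iff it holds modulo both primes, so μ(p) = lcm(μ(p₁), μ(p₂)).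
  μ-product : μ p ≡ lcm (μ p₁) (μ p₂)
  μ-product = ∣-antisym
    (Op.∣pow⇒μ∣ L (subst (_∣ 2 ^ L ∸ 1) (sym p≡)
      (distinct-primes-∣ p₁-prime p₂-prime p₁≢p₂ (O₁.μ∣⇒∣pow L (m∣lcm[m,n] (μ p₁) (μ p₂))) (O₂.μ∣⇒∣pow L (n∣lcm[m,n] (μ p₁) (μ p₂))))))
    (lcm-least (O₁.∣pow⇒μ∣ (μ p) (∣-trans p₁∣p Op.∣pow-μ)) (O₂.∣pow⇒μ∣ (μ p) (∣-trans p₂∣p Op.∣pow-μ)))
    where
    module O₁ = Order p₁ p₁-odd
    module O₂ = Order p₂ p₂-odd
    module Op = Order p p-odd
    L : ℕ
    L = lcm (μ p₁) (μ p₂)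

  partition : ∀ (M : ℕ → Bool) → count p (λ x → M x ∧ nonzero x) ≡
              count p (λ x → M x ∧ M₁.multiple x) + (count p (λ x → M x ∧ M₂.multiple x) + count p (λ x → M x ∧ unit x))
  partition M = trans (count-split p M nonzero M₁.multiple notMultiple₁ (λ x _ → cases (does (p₁ ∣? x)) (nonzero x)))
                      (cong (count p (λ x → M x ∧ M₁.multiple x) +_)
                            (count-split p M notMultiple₁ M₂.multiple unit (λ x _ → crt (p₁ ∣? x) (p₂ ∣? x) (p ∣? x))))
    where
    notMultiple₁ : ℕ → Bool
    notMultiple₁ x = not (does (p₁ ∣? x)) ∧ nonzero x
    cases : ∀ a b → ind b ≡ ind (a ∧ b) + ind (not a ∧ b)
    cases true  b = sym (+-identityʳ (ind b))
    cases false b = refl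
    crt : ∀ {x} (D₁ : Dec (p₁ ∣ x)) (D₂ : Dec (p₂ ∣ x)) (D : Dec (p ∣ x)) →
          ind (not (does D₁) ∧ not (does D)) ≡ ind (does D₂ ∧ not (does D)) + ind (not (does D₁) ∧ not (does D₂))
    crt (no _)     (no _)     (no _)     = refl
    crt (no _)     (yes _)    (no _)     = refl
    crt (no p₁∤x)  _          (yes p∣x)  = ⊥-elim (p₁∤x (∣-trans p₁∣p p∣x))
    crt (yes _)    (no _)     (no _)     = refl
    crt (yes _)    (no _)     (yes _)    = refl
    crt (yes _)    (yes _)    (yes _)    = refl
    crt {x} (yes p₁∣x) (yes p₂∣x) (no p∤x) =
      ⊥-elim (p∤x (subst (_∣ x) (sym p≡) (distinct-primes-∣ p₁-prime p₂-prime p₁≢p₂ p₁∣x p₂∣x)))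

  open Class 1 p p-odd (sym (*-identityˡ p)) unit unit-closed unit-shape

  -- Counting all residues: p = 1 + (p₂ - 1) + (p₁ - 1) + #units.
  unit-size : count p unit ≡ (p₁ ∸ 1) * (p₂ ∸ 1)
  unit-size = solve-for-units _ _ _ p₁ p₂ M₁.size M₂.size (trans (sym p≡) all-residues)
    where
    all-residues : p ≡ 1 + (count p M₁.multiple + (count p M₂.multiple + count p unit))
    all-residues = begin
      p                                                 ≡⟨ sym (count-true p) ⟩
      count p (λ _ → true)                              ≡⟨ count-split p (λ _ → true) (λ _ → true) nonzero (λ x → does (p ∣? x))
                                                             (λ x _ → ind-complement true (does (p ∣? x)) _) ⟩
      count p nonzero + count p (λ x → does (p ∣? x))   ≡⟨ cong₂ _+_ (partition (λ _ → true)) count-multiples-of-p ⟩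
      (count p M₁.multiple + (count p M₂.multiple + count p unit)) + 1 ≡⟨ +-comm (count p M₁.multiple + (count p M₂.multiple + count p unit)) 1 ⟩
      1 + (count p M₁.multiple + (count p M₂.multiple + count p unit)) ∎
      where open ≡-Reasoning
    solve-for-units : ∀ c₁ c₂ c₀ P₁ P₂ → 1 + c₁ ≡ P₂ → 1 + c₂ ≡ P₁ → P₁ * P₂ ≡ 1 + (c₁ + (c₂ + c₀)) → c₀ ≡ (P₁ ∸ 1) * (P₂ ∸ 1)
    solve-for-units c₁ c₂ c₀ _ _ refl refl e =
      sym (+-cancelˡ-≡ c₂ _ _ (trans (sym (*-suc c₂ c₁)) (+-cancelˡ-≡ c₁ _ _ (suc-injective e))))

  unit-orbits : count p (λ x → orbitMin x ∧ unit x) ≡ ((p₁ ∸ 1) * (p₂ ∸ 1)) ÷ lcm (μ p₁) (μ p₂)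
  unit-orbits = sym (÷-exact _ _ N (subst (1 ≤_) μ-product (Order.μ-positive p p-odd))
                      (trans (cong (N *_) (sym μ-product)) (trans class-count unit-size)))
    where
    N : ℕ
    N = count p (λ x → orbitMin x ∧ unit x)

  cycles : numCycles p ≡ ((p₁ ∸ 1) * (p₂ ∸ 1)) ÷ lcm (μ p₁) (μ p₂) + (p₁ ∸ 1) ÷ μ p₁ + (p₂ ∸ 1) ÷ μ p₂
  cycles = begin
    numCycles p                                           ≡⟨ cycles-as-orbits ⟩
    count p (λ x → orbitMin x ∧ nonzero x)                ≡⟨ partition orbitMin ⟩
    count p (λ x → orbitMin x ∧ M₁.multiple x) + (count p (λ x → orbitMin x ∧ M₂.multiple x) + count p (λ x → orbitMin x ∧ unit x))
      ≡⟨ cong₂ _+_ M₁.orbits (cong₂ _+_ M₂.orbits unit-orbits) ⟩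
    (p₂ ∸ 1) ÷ μ p₂ + ((p₁ ∸ 1) ÷ μ p₁ + ((p₁ ∸ 1) * (p₂ ∸ 1)) ÷ lcm (μ p₁) (μ p₂))
      ≡⟨ reorder ((p₂ ∸ 1) ÷ μ p₂) ((p₁ ∸ 1) ÷ μ p₁) (((p₁ ∸ 1) * (p₂ ∸ 1)) ÷ lcm (μ p₁) (μ p₂)) ⟩
    ((p₁ ∸ 1) * (p₂ ∸ 1)) ÷ lcm (μ p₁) (μ p₂) + (p₁ ∸ 1) ÷ μ p₁ + (p₂ ∸ 1) ÷ μ p₂ ∎
    where
    open ≡-Reasoning
    reorder : ∀ a b c → a + (b + c) ≡ c + b + a
    reorder = solve-∀

odd⇒¬2∣ : ∀ p → p % 2 ≡ 1 → ¬ 2 ∣ p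
odd⇒¬2∣ p p%2≡1 2∣p = 0≢1+n (trans (sym (n∣m⇒m%n≡0 p 2 2∣p)) p%2≡1)

corollary5p7 : (p : ℕ) → 3 ≤ p → p % 2 ≡ 1 →
    ((p₁ ℓ : ℕ) → Prime p₁ → μ (p₁ ^ 2) ≡ μ p₁ * p₁ → 1 ≤ ℓ → p ≡ p₁ ^ ℓ →
      numCycles p ≡ ((p₁ ∸ 1) ÷ μ p₁) * ℓ)
    × ((p₁ p₂ : ℕ) → Prime p₁ → Prime p₂ → p₁ ≢ p₂ → p ≡ p₁ * p₂ →
      numCycles p ≡ ((p₁ ∸ 1) * (p₂ ∸ 1)) ÷ lcm (μ p₁) (μ p₂) + (p₁ ∸ 1) ÷ μ p₁ + (p₂ ∸ 1) ÷ μ p₂)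
corollary5p7 (suc n) _ p-odd =
  (λ q ℓ q-prime hyp 1≤ℓ p≡ → PrimePower.cycles n (odd⇒¬2∣ (suc n) p-odd) q ℓ q-prime hyp 1≤ℓ p≡) ,
  (λ p₁ p₂ p₁-prime p₂-prime p₁≢p₂ p≡ → TwoPrimes.cycles n (odd⇒¬2∣ (suc n) p-odd) p₁ p₂ p₁-prime p₂-prime p₁≢p₂ p≡)
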